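{- There is an injective monoid homomorphism from $(\mathrm{PT},\cdot,\bar\epsilon)$ into the semigroup $(\mathscr B,\circ)$ of Böhm-like trees whose image is $\mathscr{HP}$.
   Context: A tree is a nonempty prefix-closed finitely branching set $A\subseteq(\mathbb N^+)^*$ with $wj\in A$, $i<j$ implying $wi\in A$. A permutation tree is a map $t:A\to\mathrm{Sym}(\mathbb N^+)$ (possibly infinite) such that a node with exactly $n$ children has label in $S_n$ (permutations of $\mathbb N^+$ fixing all $i>n$). Write $t=\langle\pi;t_1,..,t_n\rangle$; $\bar\epsilon$ is the one-node tree. $\mathrm{PT}$ is the set of permutation trees, with product defined coinductively: $t\bar\epsilon=t=\bar\epsilon t$; for $t=\langle\pi;t_1..t_n\rangle$, $u=\langle\rho;u_1..u_m\rangle$: if $n\ge m$, $tu=\langle\pi\circ\rho;u_1t_{\rho1},..,u_mt_{\rho m},t_{m+1},..,t_n\rangle$; if $m\ge n$, $tu=\langle\pi\circ\rho;u_1t_{\rho1},..,u_mt_{\rho m}\rangle$ with $t_j:=\bar\epsilon$ for $j>n$. $\mathscr B$ is the set of Böhm-like trees: coinductively, either $\bot$ or a root labelled $\lambda x_1..x_n.y$ with finitely many children in $\mathscr B$. Application and abstraction on $\mathscr B$ are computed as for $\lambda$-terms (with $\beta$-reduction), and composition is $T\circ U:=\lambda x.T(Ux)$, which makes $(\mathscr B,\circ)$ a semigroup, extending composition $M\circ N=\lambda x.M(Nx)$ of $\lambda$-terms via Böhm trees. $\mathscr{HP}(x)$ is the largest subset of $\mathscr B$ such that each $T\in\mathscr{HP}(x)$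 has the form $\lambda x_1..x_n.x\,T_1\cdots T_n$ for some $n$, $\pi\in S_n$, $T_i\in\mathscr{HP}(x_{\pi i})$; $\mathscr{HP}=\{\lambda x.T:T\in\mathscr{HP}(x)\}$. -}

module Defs where

open import Data.Nat using (ℕ; zero; suc; _+_; _∸_; _≤_; _<_; _⊔_; _<?_)
open import Data.Nat.Properties using (≤-trans; m≤m⊔n; m≤n⊔m)
open import Data.Fin using (Fin; toℕ; fromℕ<)
open import Data.List using (List; []; _∷_; length; lookup; reverse)
open import Data.List.Relation.Binary.Pointwise using (Pointwise)
open import Data.Product using (Σ; _×_; _,_; ∃)
open import Data.Unit using (⊤)
open import Data.Empty renaming (⊥ to Empty)
open import Relation.Nullary using (¬_; yes; no)
open import Relation.Binary.PropositionalEquality using (_≡_; refl; trans; cong)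
open import Relation.Binary.Construct.Closure.ReflexiveTransitive using (Star)

-- Finitary permutations.  Convention: positions are 0-based, so the
-- paper's S_n (permutations of ℕ⁺ fixing every i > n) is rendered as
-- permutations of ℕ fixing every i ≥ n (shift by one).

record Sym (n : ℕ) : Set where
  field
    to      : ℕ → ℕ
    from    : ℕ → ℕ
    to-from : ∀ i → to (from i) ≡ i
    from-to : ∀ i → from (to i) ≡ i
    fixes   : ∀ i → n ≤ i → to i ≡ i
open Sym public

idSym : (n : ℕ) → Sym n
idSym n = record { to = λ i → i ; from = λ i → i ; to-from = λ _ → refl
                 ; from-to = λ _ → refl ; fixes = λ _ _ → refl }

liftSym : ∀ {n k} → n ≤ k → Sym n → Sym k
liftSym n≤k π = record { to = to π ; from = from π ; to-from = to-from π
                       ; from-to = from-to π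
                       ; fixes = λ i k≤i → fixes π i (≤-trans n≤k k≤i) }

_∘S_ : ∀ {n} → Sym n → Sym n → Sym n
π ∘S ρ = record
  { to = λ i → to π (to ρ i)
  ; from = λ i → from ρ (from π i)
  ; to-from = λ i → trans (cong (to π) (to-from ρ (from π i))) (to-from π i)
  ; from-to = λ i → trans (cong (from ρ) (from-to π (to ρ i))) (from-to ρ i)
  ; fixes = λ i n≤i → trans (cong (to π) (fixes ρ i n≤i)) (fixes π i n≤i) }

-- Infinite trees are encoded as in the paper: via addresses.  An
-- address is a list of 0-based child indices read from the root
-- (i ∷ w = "go to child i, then follow w").

-- Permutation trees.  ar w = number of children of the node at w,
-- lab w ∈ S_{ar w} its label.  The node set A is the set of addresses
-- w with InPT t w; values at other addresses are irrelevant.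

record PT : Set where
  field
    ar  : List ℕ → ℕ
    lab : (w : List ℕ) → Sym (ar w)
open PT public

childPT : PT → ℕ → PT
childPT t i = record { ar = λ w → ar t (i ∷ w) ; lab = λ w → lab t (i ∷ w) }

InPT : PT → List ℕ → Set
InPT t [] = ⊤
InPT t (i ∷ w) = i < ar t [] × InPT (childPT t i) w

ε̄ : PT
ε̄ = record { ar = λ _ → 0 ; lab = λ _ → idSym 0 }

padChild : PT → ℕ → PT
padChild t j with j <? ar t []
... | yes _ = childPT t j
... | no _  = ε̄

-- Product of permutation trees, unfolding the paper's coinductive
-- definition address by address.  At the root: arity n ⊔ m, label π ∘ ρ;
-- the i-th child is u_i t_{ρ i}, where missing t_j, u_j are ε̄.  (For
-- n > m and i ≥ m this child is ε̄ t_i, equal to t_i since ε̄t = t; so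
-- this is the paper's product up to the equality _≈PT_ of trees.)
mutual
  prodAr : PT → PT → List ℕ → ℕ
  prodAr t u [] = ar t [] ⊔ ar u []
  prodAr t u (i ∷ w) = prodAr (padChild u i) (padChild t (to (lab u []) i)) w

  prodLab : (t u : PT) (w : List ℕ) → Sym (prodAr t u w)
  prodLab t u [] = liftSym (m≤m⊔n (ar t []) (ar u [])) (lab t [])
                ∘S liftSym (m≤n⊔m (ar t []) (ar u [])) (lab u [])
  prodLab t u (i ∷ w) = prodLab (padChild u i) (padChild t (to (lab u []) i)) w

_·_ : PT → PT → PT
t · u = record { ar = prodAr t u ; lab = prodLab t u }

-- equality of permutation trees: same node set and same labels
-- (the arities agreeing on common nodes forces the node sets to agree)
_≈PT_ : PT → PT → Set
t ≈PT u = ∀ w → InPT t w → InPT u w →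
          (ar t w ≡ ar u w) × (∀ j → to (lab t w) j ≡ to (lab u w) j)

-- Böhm-like trees, variables as de Bruijn indices.  A node label
-- `node n y k` is λx₁…xₙ.y with k children, where y is a de Bruijn
-- index in the context extended by the n binders (index 0 = xₙ, …,
-- n-1 = x₁, n + j = the j-th variable outside).  Children live in
-- that same extended context.

data BL : Set where
  ⊥B   : BL
  node : (n y k : ℕ) → BL

record 𝓑 : Set where
  field at : List ℕ → BL
open 𝓑 public

sub𝓑 : 𝓑 → ℕ → 𝓑
sub𝓑 T i = record { at = λ w → at T (i ∷ w) }

ChildOK : BL → ℕ → Set
ChildOK ⊥B i = Empty
ChildOK (node n y k) i = i < k

InB : 𝓑 → List ℕ → Set
InB T [] = ⊤
InB T (i ∷ w) = ChildOK (at T []) i × InB (sub𝓑 T i) w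

_≈B_ : 𝓑 → 𝓑 → Set
T ≈B U = ∀ w → InB T w → InB U w → at T w ≡ at U w

I𝓑 : 𝓑
I𝓑 = record { at = λ _ → node 1 0 0 }

-- Infinitary λ⊥-terms (de Bruijn), by addresses: an app node has
-- children 0 (function) and 1 (argument), a lam node has child 0.
-- These are used to compute application/composition of Böhm-like
-- trees "as for λ-terms".

data TL : Set where
  var : ℕ → TL
  app : TL
  lam : TL
  bot : TL

record Tm : Set where
  field tat : List ℕ → TL
open Tm public

subT : Tm → ℕ → Tm
subT M c = record { tat = λ w → tat M (c ∷ w) }

mkVar : ℕ → Tm
mkVar i = record { tat = λ _ → var i }

mkApp : Tm → Tm → Tm
mkApp M N = record { tat = f }
  where
  f : List ℕ → TL
  f [] = app
  f (0 ∷ w) = tat M w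
  f (1 ∷ w) = tat N w
  f (_ ∷ _) = bot

mkLam : Tm → Tm
mkLam M = record { tat = f }
  where
  f : List ℕ → TL
  f [] = lam
  f (_ ∷ w) = tat M w

renAt : (ℕ → ℕ) → ℕ → Tm → List ℕ → TL
renAt ρ d M [] with tat M []
... | var i with i <? d
...   | yes _ = var i
...   | no _  = var (d + ρ (i ∸ d))
renAt ρ d M [] | app = app
renAt ρ d M [] | lam = lam
renAt ρ d M [] | bot = bot
renAt ρ d M (c ∷ w) with tat M []
... | lam = renAt ρ (suc d) (subT M c) w
... | app = renAt ρ d (subT M c) w
... | _   = bot

rename : (ℕ → ℕ) → Tm → Tm
rename ρ M = record { tat = renAt ρ 0 M }

substAt : (ℕ → Tm) → ℕ → Tm → List ℕ → TL
substAt σ d M w with tat M []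
... | bot = bot
substAt σ d M [] | app = app
substAt σ d M (c ∷ w) | app = substAt σ d (subT M c) w
substAt σ d M [] | lam = lam
substAt σ d M (c ∷ w) | lam = substAt σ (suc d) (subT M c) w
substAt σ d M w | var i with i <? d
substAt σ d M [] | var i | yes _ = var i
substAt σ d M (_ ∷ _) | var i | yes _ = bot
substAt σ d M w | var i | no _ = renAt (d +_) 0 (σ (i ∸ d)) w

subst0 : Tm → Tm → Tm
subst0 P N = record { tat = substAt σ 0 P }
  where
  σ : ℕ → Tm
  σ zero = N
  σ (suc i) = mkVar i

-- embedding of Böhm-like trees into infinitary terms:
-- node n y k with children T₁…T_k  ↦  λ^n. y T₁ … T_k
mutual
  embAt : 𝓑 → List ℕ → TL
  embAt T w with at T []
  ... | ⊥B = bot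
  ... | node n y k = lamsAt T n y k w

  lamsAt : 𝓑 → ℕ → ℕ → ℕ → List ℕ → TL
  lamsAt T (suc m) y k [] = lam
  lamsAt T (suc m) y k (_ ∷ w) = lamsAt T m y k w
  lamsAt T zero y k w = spineAt T y k w

  spineAt : 𝓑 → ℕ → ℕ → List ℕ → TL
  spineAt T y zero [] = var y
  spineAt T y (suc j) [] = app
  spineAt T y zero (_ ∷ _) = bot
  spineAt T y (suc j) (0 ∷ w) = spineAt T y j w
  spineAt T y (suc j) (1 ∷ w) = embAt (sub𝓑 T j) w
  spineAt T y (suc j) (_ ∷ _) = bot

emb : 𝓑 → Tm
emb T = record { tat = embAt T }

NotLam : Tm → Set
NotLam M = ¬ (tat M [] ≡ lam)

data _⟶h_ : Tm → Tm → Set where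
  β    : ∀ {M} → tat M [] ≡ app → tat (subT M 0) [] ≡ lam →
         M ⟶h subst0 (subT (subT M 0) 0) (subT M 1)
  appL : ∀ {M L′} → tat M [] ≡ app → NotLam (subT M 0) → subT M 0 ⟶h L′ →
         M ⟶h mkApp L′ (subT M 1)
  lamC : ∀ {M P′} → tat M [] ≡ lam → subT M 0 ⟶h P′ → M ⟶h mkLam P′

data Spine : Tm → ℕ → List Tm → Set where
  svar : ∀ {M y} → tat M [] ≡ var y → Spine M y []
  sapp : ∀ {M y ms} → tat M [] ≡ app → Spine (subT M 0) y ms →
         Spine M y (ms Data.List.∷ʳ subT M 1)

data HNF : Tm → ℕ → ℕ → List Tm → Set where
  hbody : ∀ {M y ms} → Spine M y ms → HNF M 0 y ms
  hlam  : ∀ {M n y ms} → tat M [] ≡ lam → HNF (subT M 0) n y ms → HNF M (suc n) y ms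

HasHNF : Tm → Set
HasHNF M = Σ Tm λ M′ → Σ ℕ λ n → Σ ℕ λ y → Σ (List Tm) λ ms →
           Star _⟶h_ M M′ × HNF M′ n y ms

data BTpath : Tm → List ℕ → BL → Set where
  here-node : ∀ {M M′ n y ms} → Star _⟶h_ M M′ → HNF M′ n y ms →
              BTpath M [] (node n y (length ms))
  here-bot  : ∀ {M} → ¬ HasHNF M → BTpath M [] ⊥B
  there     : ∀ {M M′ n y ms i w L} → Star _⟶h_ M M′ → HNF M′ n y ms →
              (p : i < length ms) → BTpath (lookup ms (fromℕ< p)) w L →
              BTpath M (i ∷ w) L

BT : Tm → 𝓑 → Set
BT M T = ∀ w → InB T w → BTpath M w (at T w)

compTm : 𝓑 → 𝓑 → Tm
compTm T U = mkLam (mkApp (rename suc (emb T))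
                          (mkApp (rename suc (emb U)) (mkVar zero)))

-- Comp T U V :  V = T ∘ U   (graph of the composition on 𝓑)
Comp : 𝓑 → 𝓑 → 𝓑 → Set
Comp T U V = BT (compTm T U) V

lamsOf : BL → ℕ
lamsOf ⊥B = 0
lamsOf (node n _ _) = n

nLams : 𝓑 → List ℕ → ℕ
nLams T w = lamsOf (at T w)

-- Given a choice Π of a permutation at every node, the variable that
-- the subtree at w must have as head: x at the root, and for the i-th
-- child of a node with n binders x₁…xₙ and permutation π it is
-- x_{π i}, i.e. de Bruijn index n ∸ suc (π i) (0-based).
expVar : ℕ → (T : 𝓑) → ((w : List ℕ) → Sym (nLams T w)) → List ℕ → ℕ
expVar x T Π [] = x
expVar x T Π (i ∷ w) =
  expVar (nLams T [] ∸ suc (to (Π []) i)) (sub𝓑 T i) (λ v → Π (i ∷ v)) w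

-- T ∈ 𝓗𝓟(x) (x a de Bruijn index in the context of T): the greatest
-- fixed point, unfolded address-wise: there is a choice of π_w ∈ S_{n_w}
-- at every node w such that every node is λx₁…x_{n}. v x-children-n
-- with exactly n children and v the expected variable.
HPv : ℕ → 𝓑 → Set
HPv x T = Σ ((w : List ℕ) → Sym (nLams T w)) λ Π →
  ∀ w → InB T w →
    at T w ≡ node (nLams T w) (expVar x T Π w + nLams T w) (nLams T w)

strip : 𝓑 → 𝓑
strip T = record { at = f }
  where
  f : List ℕ → BL
  f [] with at T []
  ... | node (suc n) y k = node n y k
  ... | _ = ⊥B
  f (c ∷ w) = at T (c ∷ w)

HP : 𝓑 → Set
HP T = (Σ ℕ λ n → Σ ℕ λ y → Σ ℕ λ k → at T [] ≡ node (suc n) y k)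
     × HPv 0 (strip T)

-- φ t = λx. hpBT x t, where a node of t with permutation π and n children becomes
-- λx₁…xₙ. y T₁ … Tₙ with Tᵢ headed by x_{π i}.  Membership in 𝓗𝓟 asks for exactly this shape,
-- and π is read off from the heads of the children, so φ is injective with image 𝓗𝓟.
-- For the product, λx. φ t (φ u x) head-reduces to the tree of t with its head replaced by the
-- tree of u (a graft); β-reducing the λ's of u one at a time against the arguments of t puts
-- the (π_u i)-th argument of t into the head of the i-th argument of u.  The result is a head
-- normal form with max(n, m) binders, permutation π_t ∘ π_u and, as children, grafts of
-- (u_i, t_{π_u i}) with ε̄ for missing children: the recursion defining t · u.

module Submission where

open import Defs
open import Data.Empty using (⊥-elim)
open import Data.Fin using (fromℕ<)
open import Data.Fin.Properties using (toℕ-fromℕ<)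
open import Data.List using (List; []; _∷_; length; lookup; applyUpTo)
open import Data.List.Properties using (applyUpTo-∷ʳ; length-applyUpTo; lookup-applyUpTo)
open import Data.List.Relation.Binary.Pointwise using (Pointwise; []; _∷_; Pointwise-length; ++⁺)
open import Data.Nat using (ℕ; zero; suc; _+_; _∸_; _≤_; _<_; _⊔_; _<?_; z≤n; s≤s)
open import Data.Nat.Properties
open import Data.Product using (Σ; ∃; _×_; _,_; proj₁; proj₂)
open import Data.Sum using (inj₁; inj₂)
open import Data.Unit using (tt)
open import Function using (_∘_)
open import Function.Bundles using (_⇔_; mk⇔)
open import Relation.Nullary using (¬_; yes; no; Dec)
open import Relation.Binary.PropositionalEquality
open import Relation.Binary.Construct.Closure.ReflexiveTransitive using (Star; ε; _◅_; _◅◅_)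

-- Terms up to pointwise equality

tm : (List ℕ → TL) → Tm
tm f = record { tat = f }

infix 4 _≈T_
_≈T_ : Tm → Tm → Set
M ≈T N = ∀ w → tat M w ≡ tat N w

≈T-trans : ∀ {M N P} → M ≈T N → N ≈T P → M ≈T P
≈T-trans e f w = trans (e w) (f w)

renAt-cong : ∀ ρ d {M N} → M ≈T N → ∀ w → renAt ρ d M w ≡ renAt ρ d N w
renAt-cong ρ d {M} {N} e [] with tat M [] | tat N [] | e []
... | var i | .(var i) | refl with i <? d
...   | yes _ = refl
...   | no _ = refl
renAt-cong ρ d e [] | app | .app | refl = refl
renAt-cong ρ d e [] | lam | .lam | refl = refl
renAt-cong ρ d e [] | bot | .bot | refl = refl
renAt-cong ρ d {M} {N} e (c ∷ w) with tat M [] | tat N [] | e []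
... | var i | .(var i) | refl = refl
... | app | .app | refl = renAt-cong ρ d (λ v → e (c ∷ v)) w
... | lam | .lam | refl = renAt-cong ρ (suc d) (λ v → e (c ∷ v)) w
... | bot | .bot | refl = refl

substAt-cong : ∀ {σ σ′} → (∀ i → σ i ≈T σ′ i) → ∀ d {M N} → M ≈T N → ∀ w →
               substAt σ d M w ≡ substAt σ′ d N w
substAt-cong es d {M} {N} e w with tat M [] | tat N [] | e []
substAt-cong es d e w | bot | .bot | refl = refl
substAt-cong es d e [] | app | .app | refl = refl
substAt-cong es d e (c ∷ w) | app | .app | refl = substAt-cong es d (λ v → e (c ∷ v)) w
substAt-cong es d e [] | lam | .lam | refl = refl
substAt-cong es d e (c ∷ w) | lam | .lam | refl = substAt-cong es (suc d) (λ v → e (c ∷ v)) w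
substAt-cong es d e w | var i | .(var i) | refl with i <? d
substAt-cong es d e [] | var i | .(var i) | refl | yes _ = refl
substAt-cong es d e (_ ∷ _) | var i | .(var i) | refl | yes _ = refl
substAt-cong es d e w | var i | .(var i) | refl | no _ = renAt-cong (d +_) 0 (es (i ∸ d)) w

substAt-congʳ : ∀ σ d {M N} → M ≈T N → ∀ w → substAt σ d M w ≡ substAt σ d N w
substAt-congʳ σ d = substAt-cong {σ} {σ} (λ _ _ → refl) d

renAt≡substAt : ∀ ρ d M w → renAt ρ d M w ≡ substAt (mkVar ∘ ρ) d M w
renAt≡substAt ρ d M [] with tat M []
... | var i with i <? d
...   | yes _ = refl
...   | no _ = refl
renAt≡substAt ρ d M [] | app = refl
renAt≡substAt ρ d M [] | lam = refl
renAt≡substAt ρ d M [] | bot = refl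
renAt≡substAt ρ d M (c ∷ w) with tat M []
... | var i with i <? d
...   | yes _ = refl
...   | no _ = refl
renAt≡substAt ρ d M (c ∷ w) | app = renAt≡substAt ρ d (subT M c) w
renAt≡substAt ρ d M (c ∷ w) | lam = renAt≡substAt ρ (suc d) (subT M c) w
renAt≡substAt ρ d M (c ∷ w) | bot = refl

singleSub : Tm → ℕ → Tm
singleSub N zero = N
singleSub N (suc i) = mkVar i

subst0≈substAt : ∀ P N → subst0 P N ≈T tm (substAt (singleSub N) 0 P)
subst0≈substAt P N = substAt-cong {σ′ = singleSub N} (λ { zero _ → refl ; (suc i) _ → refl }) 0 {P} {P} (λ _ → refl)

subst0-cong : ∀ {P P′ N N′} → P ≈T P′ → N ≈T N′ → subst0 P N ≈T subst0 P′ N′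
subst0-cong {P} {P′} {N} {N′} e f w = begin
  tat (subst0 P N) w              ≡⟨ subst0≈substAt P N w ⟩
  substAt (singleSub N) 0 P w     ≡⟨ substAt-cong (λ { zero → f ; (suc i) _ → refl }) 0 e w ⟩
  substAt (singleSub N′) 0 P′ w   ≡⟨ sym (subst0≈substAt P′ N′ w) ⟩
  tat (subst0 P′ N′) w            ∎
  where open ≡-Reasoning

mkApp-cong : ∀ {A A′ B B′} → A ≈T A′ → B ≈T B′ → mkApp A B ≈T mkApp A′ B′
mkApp-cong e f [] = refl
mkApp-cong e f (zero ∷ w) = e w
mkApp-cong e f (suc zero ∷ w) = f w
mkApp-cong e f (suc (suc c) ∷ w) = refl

mkLam-cong : ∀ {A A′} → A ≈T A′ → mkLam A ≈T mkLam A′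
mkLam-cong e [] = refl
mkLam-cong e (c ∷ w) = e w

infix 4 _⟶h*≈_
_⟶h*≈_ : Tm → Tm → Set
M ⟶h*≈ N = Σ Tm λ M′ → Star _⟶h_ M M′ × M′ ≈T N

⟶h-resp-≈ : ∀ {M N N′} → M ≈T N → N ⟶h N′ → Σ Tm λ M′ → M ⟶h M′ × M′ ≈T N′
⟶h-resp-≈ e (β isApp isLam) =
  _ , β (trans (e []) isApp) (trans (e (0 ∷ [])) isLam) ,
  subst0-cong (λ w → e (0 ∷ 0 ∷ w)) (λ w → e (1 ∷ w))
⟶h-resp-≈ e (appL isApp notLam r) with ⟶h-resp-≈ (λ w → e (0 ∷ w)) r
... | _ , r′ , e′ = _ , appL (trans (e []) isApp) (λ q → notLam (trans (sym (e (0 ∷ []))) q)) r′ ,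
                    mkApp-cong e′ (λ w → e (1 ∷ w))
⟶h-resp-≈ e (lamC isLam r) with ⟶h-resp-≈ (λ w → e (0 ∷ w)) r
... | _ , r′ , e′ = _ , lamC (trans (e []) isLam) r′ , mkLam-cong e′

⟶h*-resp-≈ : ∀ {M N N′} → M ≈T N → Star _⟶h_ N N′ → M ⟶h*≈ N′
⟶h*-resp-≈ e ε = _ , ε , e
⟶h*-resp-≈ e (r ◅ rs) with ⟶h-resp-≈ e r
... | _ , r′ , e₁ with ⟶h*-resp-≈ e₁ rs
... | M₂ , rs′ , e₂ = M₂ , r′ ◅ rs′ , e₂

≈⇒⟶h*≈ : ∀ {M N} → M ≈T N → M ⟶h*≈ N
≈⇒⟶h*≈ e = _ , ε , e

⟶h*≈-≈ : ∀ {M N P} → M ⟶h*≈ N → N ≈T P → M ⟶h*≈ P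
⟶h*≈-≈ (M′ , s , e) e′ = M′ , s , ≈T-trans e e′

⟶h*≈-trans : ∀ {M N P} → M ⟶h*≈ N → N ⟶h*≈ P → M ⟶h*≈ P
⟶h*≈-trans (_ , s , e) (_ , s′ , e′) with ⟶h*-resp-≈ e s′
... | M″ , s″ , e″ = M″ , s ◅◅ s″ , ≈T-trans e″ e′

≈-⟶h-≈ : ∀ {M N N′ P} → M ≈T N → N ⟶h N′ → N′ ≈T P → M ⟶h*≈ P
≈-⟶h-≈ e r e′ with ⟶h-resp-≈ e r
... | M′ , r′ , e″ = M′ , r′ ◅ ε , ≈T-trans e″ e′

⟶h*-mkLam : ∀ {M M′} → Star _⟶h_ M M′ → Star _⟶h_ (mkLam M) (mkLam M′)
⟶h*-mkLam ε = ε
⟶h*-mkLam (r ◅ rs) = lamC refl r ◅ ⟶h*-mkLam rs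

⟶h*≈-mkLam : ∀ {M N} → M ⟶h*≈ N → mkLam M ⟶h*≈ mkLam N
⟶h*≈-mkLam (_ , s , e) = _ , ⟶h*-mkLam s , mkLam-cong e

Spine-resp-≈ : ∀ {M N y ns} → M ≈T N → Spine N y ns →
               Σ (List Tm) λ ms → Spine M y ms × Pointwise _≈T_ ms ns
Spine-resp-≈ e (svar isVar) = [] , svar (trans (e []) isVar) , []
Spine-resp-≈ e (sapp isApp s) with Spine-resp-≈ (λ w → e (0 ∷ w)) s
... | _ , s′ , ms≈ = _ , sapp (trans (e []) isApp) s′ , ++⁺ ms≈ ((λ w → e (1 ∷ w)) ∷ [])

HNF-resp-≈ : ∀ {M N n y ns} → M ≈T N → HNF N n y ns →
             Σ (List Tm) λ ms → HNF M n y ms × Pointwise _≈T_ ms ns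
HNF-resp-≈ e (hbody s) with Spine-resp-≈ e s
... | ms , s′ , ms≈ = ms , hbody s′ , ms≈
HNF-resp-≈ e (hlam isLam h) with HNF-resp-≈ (λ w → e (0 ∷ w)) h
... | ms , h′ , ms≈ = ms , hlam (trans (e []) isLam) h′ , ms≈

data BTnode : Tm → List ℕ → BL → Set where
  root  : ∀ {M M′ n y ms} → Star _⟶h_ M M′ → HNF M′ n y ms →
          BTnode M [] (node n y (length ms))
  child : ∀ {M M′ n y ms i w L} → Star _⟶h_ M M′ → HNF M′ n y ms →
          (p : i < length ms) → BTnode (lookup ms (fromℕ< p)) w L →
          BTnode M (i ∷ w) L

BTnode⇒BTpath : ∀ {M w L} → BTnode M w L → BTpath M w L
BTnode⇒BTpath (root s h) = here-node s h
BTnode⇒BTpath (child s h p b) = there s h p (BTnode⇒BTpath b)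

lookup-Pointwise : ∀ {xs ys : List Tm} → Pointwise _≈T_ xs ys →
                   ∀ i (p : i < length xs) (q : i < length ys) →
                   lookup xs (fromℕ< p) ≈T lookup ys (fromℕ< q)
lookup-Pointwise (e ∷ _) zero (s≤s _) (s≤s _) = e
lookup-Pointwise (_ ∷ es) (suc i) (s≤s p) (s≤s q) = lookup-Pointwise es i p q

BTnode-resp-≈ : ∀ {M N w L} → M ≈T N → BTnode N w L → BTnode M w L
BTnode-resp-≈ e (root s h) with ⟶h*-resp-≈ e s
... | _ , s′ , e′ with HNF-resp-≈ e′ h
... | _ , h′ , ms≈ rewrite sym (Pointwise-length ms≈) = root s′ h′
BTnode-resp-≈ e (child {i = i} s h p b) with ⟶h*-resp-≈ e s
... | _ , s′ , e′ with HNF-resp-≈ e′ h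
... | ms′ , h′ , ms≈ = child s′ h′ p′ (BTnode-resp-≈ (lookup-Pointwise ms≈ i p′ p) b)
  where
  p′ : i < length ms′
  p′ = subst (i <_) (sym (Pointwise-length ms≈)) p

BTnode-⟶h*≈ : ∀ {M N w L} → M ⟶h*≈ N → BTnode N w L → BTnode M w L
BTnode-⟶h*≈ (_ , s , e) b with BTnode-resp-≈ e b
... | root s′ h = root (s ◅◅ s′) h
... | child s′ h p b′ = child (s ◅◅ s′) h p b′

BTnode-mkLam-root : ∀ {M n y k} → BTnode M [] (node n y k) → BTnode (mkLam M) [] (node (suc n) y k)
BTnode-mkLam-root (root s h) = root (⟶h*-mkLam s) (hlam refl h)

BTnode-mkLam-child : ∀ {M i w L} → BTnode M (i ∷ w) L → BTnode (mkLam M) (i ∷ w) L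
BTnode-mkLam-child (child s h p b) = child (⟶h*-mkLam s) (hlam refl h) p b

varAt : ℕ → List ℕ → TL
varAt y [] = var y
varAt y (_ ∷ _) = bot

appAt : (List ℕ → TL) → (List ℕ → TL) → List ℕ → TL
appAt f g [] = app
appAt f g (zero ∷ w) = f w
appAt f g (suc zero ∷ w) = g w
appAt f g (suc (suc _) ∷ w) = bot

apps : ℕ → (List ℕ → TL) → (ℕ → List ℕ → TL) → List ℕ → TL
apps zero hd args = hd
apps (suc r) hd args = appAt (apps r hd args) (args r)

lamsApps : ℕ → ℕ → (List ℕ → TL) → (ℕ → List ℕ → TL) → List ℕ → TL
lamsApps (suc p) r hd args [] = lam
lamsApps (suc p) r hd args (_ ∷ w) = lamsApps p r hd args w
lamsApps zero r hd args = apps r hd args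

apps-cong : ∀ r {hd hd′ args args′} w → (∀ v → hd v ≡ hd′ v) →
            (∀ j v → j < r → length v < length w → args j v ≡ args′ j v) →
            apps r hd args w ≡ apps r hd′ args′ w
apps-cong zero w hd≡ args≡ = hd≡ w
apps-cong (suc r) [] hd≡ args≡ = refl
apps-cong (suc r) (zero ∷ w) hd≡ args≡ =
  apps-cong r w hd≡ (λ j v j<r v<w → args≡ j v (m≤n⇒m≤1+n j<r) (m≤n⇒m≤1+n v<w))
apps-cong (suc r) (suc zero ∷ w) hd≡ args≡ = args≡ r w ≤-refl ≤-refl
apps-cong (suc r) (suc (suc _) ∷ w) hd≡ args≡ = refl

lamsApps-cong : ∀ p r {hd hd′ args args′} w → (∀ v → hd v ≡ hd′ v) →
                (∀ j v → j < r → length v < length w → args j v ≡ args′ j v) →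
                lamsApps p r hd args w ≡ lamsApps p r hd′ args′ w
lamsApps-cong (suc p) r [] hd≡ args≡ = refl
lamsApps-cong (suc p) r (_ ∷ w) hd≡ args≡ =
  lamsApps-cong p r w hd≡ (λ j v j<r v<w → args≡ j v j<r (m≤n⇒m≤1+n v<w))
lamsApps-cong zero r w hd≡ args≡ = apps-cong r w hd≡ args≡

lamsApps-cong′ : ∀ p r {hd hd′ args args′} w → (∀ v → hd v ≡ hd′ v) →
                 (∀ j v → j < r → args j v ≡ args′ j v) →
                 lamsApps p r hd args w ≡ lamsApps p r hd′ args′ w
lamsApps-cong′ p r w hd≡ args≡ = lamsApps-cong p r w hd≡ (λ j v j<r _ → args≡ j v j<r)

substAt-varAt-< : ∀ σ d y w → y < d → substAt σ d (tm (varAt y)) w ≡ varAt y w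
substAt-varAt-< σ d y w y<d with y <? d
substAt-varAt-< σ d y [] y<d | yes _ = refl
substAt-varAt-< σ d y (_ ∷ _) y<d | yes _ = refl
... | no y≮d = ⊥-elim (y≮d y<d)

substAt-varAt-≥ : ∀ σ d y w → ¬ y < d → substAt σ d (tm (varAt y)) w ≡ renAt (d +_) 0 (σ (y ∸ d)) w
substAt-varAt-≥ σ d y w y≮d with y <? d
... | yes y<d = ⊥-elim (y≮d y<d)
... | no _ = refl

renAt-var : ∀ ρ M v w → tat M [] ≡ var v → renAt ρ 0 M w ≡ varAt (ρ v) w
renAt-var ρ M v [] isVar with tat M [] | isVar
... | _ | refl = refl
renAt-var ρ M v (_ ∷ _) isVar with tat M [] | isVar
... | _ | refl = refl

substAt-apps : ∀ σ d r hd args w →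
               substAt σ d (tm (apps r hd args)) w ≡
               apps r (substAt σ d (tm hd)) (λ j → substAt σ d (tm (args j))) w
substAt-apps σ d zero hd args w = refl
substAt-apps σ d (suc r) hd args [] = refl
substAt-apps σ d (suc r) hd args (zero ∷ w) = substAt-apps σ d r hd args w
substAt-apps σ d (suc r) hd args (suc zero ∷ w) = refl
substAt-apps σ d (suc r) hd args (suc (suc _) ∷ w) = refl

substAt-lamsApps : ∀ σ d p r hd args w →
                   substAt σ d (tm (lamsApps p r hd args)) w ≡
                   lamsApps p r (substAt σ (p + d) (tm hd)) (λ j → substAt σ (p + d) (tm (args j))) w
substAt-lamsApps σ d (suc p) r hd args [] = refl
substAt-lamsApps σ d (suc p) r hd args (_ ∷ w) rewrite sym (+-suc p d) =
  substAt-lamsApps σ (suc d) p r hd args w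
substAt-lamsApps σ d zero r hd args w = substAt-apps σ d r hd args w

substAt₀-lamsApps : ∀ σ p r hd args w →
                    substAt σ 0 (tm (lamsApps p r hd args)) w ≡
                    lamsApps p r (substAt σ p (tm hd)) (λ j → substAt σ p (tm (args j))) w
substAt₀-lamsApps σ p r hd args w =
  trans (substAt-lamsApps σ 0 p r hd args w)
        (cong (λ d → lamsApps p r (substAt σ d (tm hd)) (λ j → substAt σ d (tm (args j))) w) (+-identityʳ p))

apps-shift : ∀ r hd args w → apps (suc r) hd args w ≡ apps r (appAt hd (args 0)) (args ∘ suc) w
apps-shift zero hd args w = refl
apps-shift (suc r) hd args [] = refl
apps-shift (suc r) hd args (zero ∷ w) = apps-shift r hd args w
apps-shift (suc r) hd args (suc zero ∷ w) = refl
apps-shift (suc r) hd args (suc (suc _) ∷ w) = refl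

lamsApps-shift : ∀ p r hd args w →
                 lamsApps p (suc r) hd args w ≡ lamsApps p r (appAt hd (args 0)) (args ∘ suc) w
lamsApps-shift (suc p) r hd args [] = refl
lamsApps-shift (suc p) r hd args (_ ∷ w) = lamsApps-shift p r hd args w
lamsApps-shift zero r hd args w = apps-shift r hd args w

apps-notLam : ∀ r (hd : Tm) args → NotLam hd → NotLam (tm (apps r (tat hd) args))
apps-notLam zero hd args notLam = notLam
apps-notLam (suc r) hd args notLam ()

lamsApps-⟶h : ∀ p r (hd : Tm) args {hd′} → NotLam hd → hd ⟶h hd′ →
              Σ Tm λ M′ → tm (lamsApps p r (tat hd) args) ⟶h M′ × M′ ≈T tm (lamsApps p r (tat hd′) args)
lamsApps-⟶h (suc p) r hd args notLam red with lamsApps-⟶h p r hd args notLam red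
... | M′ , red′ , e = mkLam M′ , lamC refl red′ , λ { [] → refl ; (_ ∷ w) → e w }
lamsApps-⟶h zero zero hd args notLam red = _ , red , λ _ → refl
lamsApps-⟶h zero (suc r) hd args notLam red with lamsApps-⟶h zero r hd args notLam red
... | M′ , red′ , e = mkApp M′ (tm (args r)) , appL refl (apps-notLam r hd args notLam) red′ ,
   λ { [] → refl ; (zero ∷ w) → e w ; (suc zero ∷ w) → refl ; (suc (suc _) ∷ w) → refl }

appendArgs : ℕ → (ℕ → List ℕ → TL) → (ℕ → List ℕ → TL) → ℕ → List ℕ → TL
appendArgs n a b i with i <? n
... | yes _ = a i
... | no _ = b (i ∸ n)

appendArgs-< : ∀ n a b i w → i < n → appendArgs n a b i w ≡ a i w
appendArgs-< n a b i w i<n with i <? n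
... | yes _ = refl
... | no i≮n = ⊥-elim (i≮n i<n)

appendArgs-≥ : ∀ n a b i w → ¬ i < n → appendArgs n a b i w ≡ b (i ∸ n) w
appendArgs-≥ n a b i w i≮n with i <? n
... | yes i<n = ⊥-elim (i≮n i<n)
... | no _ = refl

apps-apps : ∀ r n hd a b w → apps r (apps n hd a) b w ≡ apps (r + n) hd (appendArgs n a b) w
apps-apps zero n hd a b w = apps-cong n w (λ _ → refl) (λ j v j<n _ → sym (appendArgs-< n a b j v j<n))
apps-apps (suc r) n hd a b [] = refl
apps-apps (suc r) n hd a b (zero ∷ w) = apps-apps r n hd a b w
apps-apps (suc r) n hd a b (suc zero ∷ w) =
  sym (trans (appendArgs-≥ n a b (r + n) w (m+n≮n r n)) (cong (λ z → b z w) (m+n∸n≡m r n)))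
apps-apps (suc r) n hd a b (suc (suc _) ∷ w) = refl

lamsApps-apps : ∀ p r n hd a b w → lamsApps p r (apps n hd a) b w ≡ lamsApps p (r + n) hd (appendArgs n a b) w
lamsApps-apps (suc p) r n hd a b [] = refl
lamsApps-apps (suc p) r n hd a b (_ ∷ w) = lamsApps-apps p r n hd a b w
lamsApps-apps zero r n hd a b w = apps-apps r n hd a b w

lamsApps-lamsApps : ∀ p q r hd a b w → lamsApps p 0 (lamsApps q r hd a) b w ≡ lamsApps (p + q) r hd a w
lamsApps-lamsApps (suc p) q r hd a b [] = refl
lamsApps-lamsApps (suc p) q r hd a b (_ ∷ w) = lamsApps-lamsApps p q r hd a b w
lamsApps-lamsApps zero q r hd a b w = refl

Spine-apps : ∀ r y F → Spine (tm (apps r (varAt y) F)) y (applyUpTo (tm ∘ F) r)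
Spine-apps zero y F = svar refl
Spine-apps (suc r) y F =
  subst (Spine (tm (apps (suc r) (varAt y) F)) y) (applyUpTo-∷ʳ (tm ∘ F) r) (sapp refl (Spine-apps r y F))

HNF-lamsApps : ∀ p r y F → HNF (tm (lamsApps p r (varAt y) F)) p y (applyUpTo (tm ∘ F) r)
HNF-lamsApps (suc p) r y F = hlam refl (HNF-lamsApps p r y F)
HNF-lamsApps zero r y F = hbody (Spine-apps r y F)

spineAt≡apps : ∀ T y k w → spineAt T y k w ≡ apps k (varAt y) (λ j → embAt (sub𝓑 T j)) w
spineAt≡apps T y zero [] = refl
spineAt≡apps T y zero (_ ∷ _) = refl
spineAt≡apps T y (suc k) [] = refl
spineAt≡apps T y (suc k) (zero ∷ w) = spineAt≡apps T y k w
spineAt≡apps T y (suc k) (suc zero ∷ w) = refl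
spineAt≡apps T y (suc k) (suc (suc _) ∷ w) = refl

lamsAt≡lamsApps : ∀ T p y k w → lamsAt T p y k w ≡ lamsApps p k (varAt y) (λ j → embAt (sub𝓑 T j)) w
lamsAt≡lamsApps T (suc p) y k [] = refl
lamsAt≡lamsApps T (suc p) y k (_ ∷ w) = lamsAt≡lamsApps T p y k w
lamsAt≡lamsApps T zero y k w = spineAt≡apps T y k w

m<n⇒m+o<o+n : ∀ {m n} o → m < n → m + o < o + n
m<n⇒m+o<o+n {m} {n} o m<n = subst (m + o <_) (+-comm n o) (+-monoˡ-< o m<n)

m≮n⇒m+o≮o+n : ∀ {m n} o → ¬ m < n → ¬ m + o < o + n
m≮n⇒m+o≮o+n {m} {n} o m≮n lt = m≮n (+-cancelʳ-< o m n (subst (m + o <_) (+-comm o n) lt))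

[m+o]∸[o+n]≡m∸n : ∀ m n o → m + o ∸ (o + n) ≡ m ∸ n
[m+o]∸[o+n]≡m∸n m n o = trans (cong (_∸ (o + n)) (+-comm m o)) ([m+n]∸[m+o]≡n∸o o m n)

o+n+m≡n+m+o : ∀ m n o → o + n + m ≡ n + m + o
o+n+m≡n+m+o m n o = trans (+-assoc o n m) (+-comm o (n + m))

m+[1+n]∸n≡1+m : ∀ m n → m + suc n ∸ n ≡ suc m
m+[1+n]∸n≡1+m m n = trans (cong (_∸ n) (+-suc m n)) (m+n∸n≡m (suc m) n)

m+[1+n]≮n : ∀ m n → ¬ m + suc n < n
m+[1+n]≮n m n = subst (λ z → ¬ z < n) (sym (+-suc m n)) (m+n≮n (suc m) n)

permute-< : ∀ {n} (π : Sym n) i → i < n → to π i < n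
permute-< {n} π i i<n with to π i <? n
... | yes πi<n = πi<n
... | no πi≮n = ⊥-elim (πi≮n (subst (_< n) (sym πi≡i) i<n))
  where
  fixes-πi : to π (to π i) ≡ to π i
  fixes-πi = fixes π (to π i) (≮⇒≥ πi≮n)
  πi≡i : to π i ≡ i
  πi≡i = trans (sym (from-to π (to π i))) (trans (cong (from π) fixes-πi) (from-to π i))

padChild-< : ∀ t i → i < ar t [] → padChild t i ≡ childPT t i
padChild-< t i i<n with i <? ar t []
... | yes _ = refl
... | no i≮n = ⊥-elim (i≮n i<n)

-- Hereditary permutations as terms

-- de Bruijn index of x_{π i} under the binders x₁ … xₙ of the root of t (π its label)
argVar : PT → ℕ → ℕ
argVar t i = ar t [] ∸ suc (to (lab t []) i)

argVar-< : ∀ t d i → i < ar t [] → argVar t i < ar t [] + d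
argVar-< t d i i<n with ar t []
... | suc n = s≤s (≤-trans (m∸n≤m n (to (lab t []) i)) (m≤m+n n d))

hpBTAt : ℕ → PT → List ℕ → BL
hpBTAt x t [] = node (ar t []) (x + ar t []) (ar t [])
hpBTAt x t (i ∷ w) = hpBTAt (argVar t i) (childPT t i) w

hpBT : ℕ → PT → 𝓑
hpBT x t = record { at = hpBTAt x t }

hpTm : ℕ → PT → List ℕ → TL
hpTm x t = embAt (hpBT x t)

hpArgs : PT → ℕ → List ℕ → TL
hpArgs t i = hpTm (argVar t i) (childPT t i)

hpTm-unfold : ∀ x t w → hpTm x t w ≡ lamsApps (ar t []) (ar t []) (varAt (x + ar t [])) (hpArgs t) w
hpTm-unfold x t = lamsAt≡lamsApps (hpBT x t) (ar t []) (x + ar t []) (ar t [])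

-- The fuel n bounds the length of the address, so that recursion into the children is structural.
substAt-hpTm-closed : ∀ n σ d x t w → length w < n → x < d → substAt σ d (tm (hpTm x t)) w ≡ hpTm x t w
substAt-hpTm-closed (suc n) σ d x t w w<n x<d = begin
  substAt σ d (tm (hpTm x t)) w
    ≡⟨ substAt-congʳ σ d (hpTm-unfold x t) w ⟩
  substAt σ d (tm (lamsApps k k (varAt (x + k)) (hpArgs t))) w
    ≡⟨ substAt-lamsApps σ d k k (varAt (x + k)) (hpArgs t) w ⟩
  lamsApps k k (substAt σ (k + d) (tm (varAt (x + k)))) (λ j → substAt σ (k + d) (tm (hpArgs t j))) w
    ≡⟨ lamsApps-cong k k w (λ v → substAt-varAt-< σ (k + d) (x + k) v (m<n⇒m+o<o+n k x<d))
         (λ j v j<k v<w → substAt-hpTm-closed n σ (k + d) (argVar t j) (childPT t j) v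
                            (≤-trans v<w (≤-pred w<n)) (argVar-< t d j j<k)) ⟩
  lamsApps k k (varAt (x + k)) (hpArgs t) w
    ≡⟨ sym (hpTm-unfold x t w) ⟩
  hpTm x t w ∎
  where
  open ≡-Reasoning
  k : ℕ
  k = ar t []

substAt-hpArgs : ∀ σ d t j w → j < ar t [] → substAt σ (ar t [] + d) (tm (hpArgs t j)) w ≡ hpArgs t j w
substAt-hpArgs σ d t j w j<k =
  substAt-hpTm-closed (suc (length w)) σ (ar t [] + d) (argVar t j) (childPT t j) w ≤-refl (argVar-< t d j j<k)

-- Only the head variable of hpTm x t is free.
substAt-hpTm : ∀ σ d x t w →
               substAt σ d (tm (hpTm x t)) w ≡
               lamsApps (ar t []) (ar t []) (substAt σ (ar t [] + d) (tm (varAt (x + ar t [])))) (hpArgs t) w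
substAt-hpTm σ d x t w =
  trans (substAt-congʳ σ d (hpTm-unfold x t) w)
  (trans (substAt-lamsApps σ d k k (varAt (x + k)) (hpArgs t) w)
         (lamsApps-cong′ k k w (λ _ → refl) (λ j v j<k → substAt-hpArgs σ d t j v j<k)))
  where
  k : ℕ
  k = ar t []

substAt-hpTm-≥ : ∀ σ d x t w → ¬ x < d →
                 substAt σ d (tm (hpTm x t)) w ≡
                 lamsApps (ar t []) (ar t []) (renAt ((ar t [] + d) +_) 0 (σ (x ∸ d))) (hpArgs t) w
substAt-hpTm-≥ σ d x t w x≮d =
  trans (substAt-hpTm σ d x t w)
        (lamsApps-cong′ k k w (λ v → trans (substAt-varAt-≥ σ (k + d) (x + k) v (m≮n⇒m+o≮o+n k x≮d))
                                        (cong (λ z → renAt ((k + d) +_) 0 (σ z) v) ([m+o]∸[o+n]≡m∸n x d k)))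
                              (λ _ _ _ → refl))
  where
  k : ℕ
  k = ar t []

substAt-hpTm-var : ∀ σ d x t v w → ¬ x < d → tat (σ (x ∸ d)) [] ≡ var v →
                   substAt σ d (tm (hpTm x t)) w ≡ hpTm (d + v) t w
substAt-hpTm-var σ d x t v w x≮d σx≡v =
  trans (substAt-hpTm-≥ σ d x t w x≮d)
  (trans (lamsApps-cong′ k k w (λ u → trans (renAt-var ((k + d) +_) (σ (x ∸ d)) v u σx≡v)
                                            (cong (λ z → varAt z u) (o+n+m≡n+m+o v d k)))
                               (λ _ _ _ → refl))
         (sym (hpTm-unfold (d + v) t w)))
  where
  k : ℕ
  k = ar t []

renAt-hpTm : ∀ ρ v t w → renAt ρ 0 (tm (hpTm v t)) w ≡ hpTm (ρ v) t w
renAt-hpTm ρ v t w =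
  trans (renAt≡substAt ρ 0 (tm (hpTm v t)) w) (substAt-hpTm-var (mkVar ∘ ρ) 0 v t (ρ v) w (λ ()) refl)

renAt-hpTm-closed : ∀ ρ d x t w → x < d → renAt ρ d (tm (hpTm x t)) w ≡ hpTm x t w
renAt-hpTm-closed ρ d x t w x<d =
  trans (renAt≡substAt ρ d (tm (hpTm x t)) w) (substAt-hpTm-closed (suc (length w)) (mkVar ∘ ρ) d x t w ≤-refl x<d)

-- Grafts

-- hpTm x t with its head variable replaced by hpTm (x + n) s, n the arity of the root of t;
-- it stands for the product t · s
graft : ℕ → PT → PT → List ℕ → TL
graft x s t = lamsApps (ar t []) (ar t []) (hpTm (x + ar t []) s) (hpArgs t)

substAt-hpTm-hpTm : ∀ σ d x t v s w → ¬ x < d → σ (x ∸ d) ≈T tm (hpTm v s) →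
                    substAt σ d (tm (hpTm x t)) w ≡ graft (d + v) s t w
substAt-hpTm-hpTm σ d x t v s w x≮d σx≈s =
  trans (substAt-hpTm-≥ σ d x t w x≮d)
        (lamsApps-cong′ k k w (λ u → trans (renAt-cong _ 0 σx≈s u)
                                     (trans (renAt-hpTm ((k + d) +_) v s u)
                                            (cong (λ z → hpTm z s u) (o+n+m≡n+m+o v d k))))
                              (λ _ _ _ → refl))
  where
  k : ℕ
  k = ar t []

substAt-graft-var : ∀ σ d x s t v w → ¬ x < d → tat (σ (x ∸ d)) [] ≡ var v →
                    substAt σ d (tm (graft x s t)) w ≡ graft (d + v) s t w
substAt-graft-var σ d x s t v w x≮d σx≡v =
  trans (substAt-lamsApps σ d k k (hpTm (x + k) s) (hpArgs t) w)
        (lamsApps-cong′ k k w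
          (λ u → trans (substAt-hpTm-var σ (k + d) (x + k) s v u (m≮n⇒m+o≮o+n k x≮d)
                                         (subst (λ z → tat (σ z) [] ≡ var v) (sym ([m+o]∸[o+n]≡m∸n x d k)) σx≡v))
                       (cong (λ z → hpTm z s u) (o+n+m≡n+m+o v d k)))
          (λ j u j<k → substAt-hpArgs σ d t j u j<k))
  where
  k : ℕ
  k = ar t []

graft-identityʳ : ∀ x t w → graft x ε̄ t w ≡ hpTm x t w
graft-identityʳ x t w =
  trans (lamsApps-cong′ k k w (λ u → trans (hpTm-unfold (x + k) ε̄ u) (cong (λ z → varAt z u) (+-identityʳ (x + k))))
                              (λ _ _ _ → refl))
        (sym (hpTm-unfold x t w))
  where
  k : ℕ
  k = ar t []

graft-identityˡ : ∀ x s w → graft x s ε̄ w ≡ hpTm x s w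
graft-identityˡ x s w = cong (λ z → hpTm z s w) (+-identityʳ x)

module GraftReduction (x : ℕ) (s t : PT) where
  private
    m l : ℕ
    m = ar t []
    l = ar s []
    π : Sym l
    π = lab s []

  -- the i-th argument of the spine of s once the first j of its q + j λ's are β-reduced
  reducedArg : ℕ → ℕ → ℕ → List ℕ → TL
  reducedArg j q i with to π i <? j
  ... | yes _ = graft (argVar t (to π i) + q) (childPT t (to π i)) (childPT s i)
  ... | no _ = hpArgs s i

  reducedArg-< : ∀ j q i w → to π i < j →
                 reducedArg j q i w ≡ graft (argVar t (to π i) + q) (childPT t (to π i)) (childPT s i) w
  reducedArg-< j q i w πi<j with to π i <? j
  ... | yes _ = refl
  ... | no πi≮j = ⊥-elim (πi≮j πi<j)

  reducedArg-≥ : ∀ j q i w → ¬ to π i < j → reducedArg j q i w ≡ hpArgs s i w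
  reducedArg-≥ j q i w πi≮j with to π i <? j
  ... | yes πi<j = ⊥-elim (πi≮j πi<j)
  ... | no _ = refl

  -- s after j β-steps, with q λ's still pending
  pending : ℕ → ℕ → List ℕ → TL
  pending j q = lamsApps q l (varAt (x + m + q)) (reducedArg j q)

  -- graft x s t after j β-steps: q λ's of s and r arguments of t remain
  afterSteps : ℕ → ℕ → ℕ → List ℕ → TL
  afterSteps j q r = lamsApps m r (pending j q) (λ i → hpArgs t (i + j))

  graft≈afterSteps : tm (graft x s t) ≈T tm (afterSteps 0 l m)
  graft≈afterSteps w =
    lamsApps-cong′ m m w (λ v → trans (hpTm-unfold (x + m) s v) (lamsApps-cong′ l l v (λ _ → refl) noneReduced))
                         (λ i v _ → cong (λ z → hpArgs t z v) (sym (+-identityʳ i)))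
    where
    noneReduced : ∀ i v → i < l → hpArgs s i v ≡ reducedArg 0 l i v
    noneReduced i v _ = sym (reducedArg-≥ 0 l i v (λ ()))

  module _ {j q : ℕ} (j+1+q≡l : j + suc q ≡ l) where

    l∸[1+j]≡q : l ∸ suc j ≡ q
    l∸[1+j]≡q = trans (cong (_∸ suc j) (sym j+1+q≡l))
                      (trans (cong (_∸ suc j) (+-suc j q)) (m+n∸m≡n (suc j) q))

    substAt-head : ∀ w → substAt (singleSub (tm (hpArgs t j))) q (tm (varAt (x + m + suc q))) w ≡
                         varAt (x + m + q) w
    substAt-head w =
      trans (substAt-varAt-≥ _ q (x + m + suc q) w (m+[1+n]≮n (x + m) q))
      (trans (cong (λ z → renAt (q +_) 0 (singleSub (tm (hpArgs t j)) z) w) (m+[1+n]∸n≡1+m (x + m) q))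
      (trans (renAt-var (q +_) (mkVar (x + m)) (x + m) w refl) (cong (λ z → varAt z w) (+-comm q (x + m)))))

    substAt-hpArgs-hit : ∀ i p w → p ≡ j →
                         substAt (singleSub (tm (hpArgs t j))) q (tm (hpTm (l ∸ suc p) (childPT s i))) w ≡
                         graft (argVar t p + q) (childPT t p) (childPT s i) w
    substAt-hpArgs-hit i .j w refl =
      trans (substAt-hpTm-hpTm _ q (l ∸ suc j) (childPT s i) (argVar t j) (childPT t j) w
               (<-irrefl l∸[1+j]≡q)
               (λ v → cong (λ z → tat (singleSub (tm (hpArgs t j)) z) v)
                           (trans (cong (_∸ q) l∸[1+j]≡q) (n∸n≡0 q))))
            (cong (λ z → graft z (childPT t j) (childPT s i) w) (+-comm q (argVar t j)))

    -- Substituting for x_j = index q reaches exactly the arguments with π i = j; the others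
    -- are either closed below q or have their outer head variable renamed.
    substAt-reducedArg : ∀ i w → i < l →
                         substAt (singleSub (tm (hpArgs t j))) q (tm (reducedArg j (suc q) i)) w ≡
                         reducedArg (suc j) q i w
    substAt-reducedArg i w i<l with to π i <? j | to π i <? suc j
    ... | yes _ | yes _ =
      trans (substAt-graft-var _ q (a + suc q) (childPT t (to π i)) (childPT s i) a w (m+[1+n]≮n a q)
               (cong (λ z → tat (singleSub (tm (hpArgs t j)) z) []) (m+[1+n]∸n≡1+m a q)))
            (cong (λ z → graft z (childPT t (to π i)) (childPT s i) w) (+-comm q a))
      where
      a : ℕ
      a = argVar t (to π i)
    ... | yes πi<j | no πi≮1+j = ⊥-elim (πi≮1+j (m<n⇒m<1+n πi<j))
    ... | no πi≮j | yes πi<1+j = substAt-hpArgs-hit i (to π i) w (≤-antisym (≤-pred πi<1+j) (≮⇒≥ πi≮j))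
    ... | no πi≮j | no πi≮1+j =
      substAt-hpTm-closed (suc (length w)) _ q (argVar s i) (childPT s i) w ≤-refl
        (subst (argVar s i <_) l∸[1+j]≡q (∸-monoʳ-< (s≤s (≮⇒≥ πi≮1+j)) (permute-< π i i<l)))

    contract-body : ∀ w → tat (subst0 (tm (lamsApps q l (varAt (x + m + suc q)) (reducedArg j (suc q))))
                                      (tm (hpArgs t j))) w ≡
                          lamsApps q l (varAt (x + m + q)) (reducedArg (suc j) q) w
    contract-body w =
      trans (subst0≈substAt (tm (lamsApps q l (varAt (x + m + suc q)) (reducedArg j (suc q)))) (tm (hpArgs t j)) w)
      (trans (substAt₀-lamsApps _ q l (varAt (x + m + suc q)) (reducedArg j (suc q)) w)
             (lamsApps-cong′ q l w substAt-head substAt-reducedArg))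

  β-step : ∀ j q r → j + suc q ≡ l → tm (afterSteps j (suc q) (suc r)) ⟶h*≈ tm (afterSteps (suc j) q r)
  β-step j q r j+1+q≡l
    with lamsApps-⟶h m r (tm (appAt (pending j (suc q)) (hpArgs t j))) (λ i → hpArgs t (suc i + j)) (λ ()) (β refl refl)
  ... | _ , contraction , contracted≈ =
    ≈-⟶h-≈ (lamsApps-shift m r (pending j (suc q)) (λ i → hpArgs t (i + j)))
           contraction
           (≈T-trans contracted≈
             (λ w → lamsApps-cong′ m r w (contract-body j+1+q≡l) (λ i v _ → cong (λ z → hpArgs t z v) (sym (+-suc i j)))))

  β-steps : ∀ k j q r → j + k + q ≡ l → tm (afterSteps j (k + q) (k + r)) ⟶h*≈ tm (afterSteps (j + k) q r)
  β-steps zero j q r _ = ≈⇒⟶h*≈ (λ w → cong (λ z → afterSteps z q r w) (sym (+-identityʳ j)))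
  β-steps (suc k) j q r j+k+q≡l =
    ⟶h*≈-trans (β-step j (k + q) (k + r) (trans (sym (+-assoc j (suc k) q)) j+k+q≡l))
      (⟶h*≈-≈ (β-steps k (suc j) q r (trans (cong (_+ q) (sym (+-suc j k))) j+k+q≡l))
              (λ w → cong (λ z → afterSteps z q r w) (sym (+-suc j k))))

  -- If s has no more binders than t has arguments, the surplus arguments of t end up as
  -- arguments of the result; otherwise the surplus λ's of s remain binders.  Either way the
  -- missing children are ε̄, which graft-identityˡ/ʳ absorb.
  GraftHNF : ℕ → Set
  GraftHNF N = Σ (ℕ → List ℕ → TL) λ F →
      tm (graft x s t) ⟶h*≈ tm (lamsApps N N (varAt (x + N)) F) ×
      (∀ i → i < N → tm (F i) ≈T
                     tm (graft (N ∸ suc (to (lab t []) (to π i))) (padChild t (to π i)) (padChild s i)))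

  graft-hnf-≤ : l ≤ m → ∀ N → m ≡ N → GraftHNF N
  graft-hnf-≤ l≤m .m refl = F , reduction , args≈
    where
    F : ℕ → List ℕ → TL
    F = appendArgs l (reducedArg l 0) (λ i → hpArgs t (i + l))
    reduction : tm (graft x s t) ⟶h*≈ tm (lamsApps m m (varAt (x + m)) F)
    reduction =
      ⟶h*≈-trans
        (≈⇒⟶h*≈ (≈T-trans graft≈afterSteps
                  (λ w → cong₂ (λ a b → afterSteps 0 a b w) (sym (+-identityʳ l)) (sym (m+[n∸m]≡n l≤m)))))
        (⟶h*≈-≈ (β-steps l 0 0 (m ∸ l) (+-identityʳ l))
                (λ w → trans (lamsApps-apps m (m ∸ l) l (varAt (x + m + 0)) (reducedArg l 0) (λ i → hpArgs t (i + l)) w)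
                             (cong₂ (λ a b → lamsApps m a (varAt b) F w) (m∸n+n≡m l≤m) (+-identityʳ (x + m)))))
    args≈ : ∀ i → i < m → tm (F i) ≈T
                          tm (graft (argVar t (to π i)) (padChild t (to π i)) (padChild s i))
    args≈ i i<m w with i <? l
    ... | yes i<l
      rewrite padChild-< t (to π i) (≤-trans (permute-< π i i<l) l≤m) =
      trans (reducedArg-< l 0 i w (permute-< π i i<l))
            (cong (λ z → graft z (childPT t (to π i)) (childPT s i) w) (+-identityʳ _))
    ... | no i≮l
      rewrite fixes π i (≮⇒≥ i≮l) | padChild-< t i i<m =
      trans (cong (λ z → hpArgs t z w) (m∸n+n≡m (≮⇒≥ i≮l))) (sym (graft-identityˡ (argVar t i) (childPT t i) w))

  graft-hnf-≥ : m ≤ l → ∀ N → l ≡ N → GraftHNF N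
  graft-hnf-≥ m≤l .l refl = F , reduction , args≈
    where
    F : ℕ → List ℕ → TL
    F = reducedArg m (l ∸ m)
    reduction : tm (graft x s t) ⟶h*≈ tm (lamsApps l l (varAt (x + l)) F)
    reduction =
      ⟶h*≈-trans
        (≈⇒⟶h*≈ (≈T-trans graft≈afterSteps
                  (λ w → cong₂ (λ a b → afterSteps 0 a b w) (sym (m+[n∸m]≡n m≤l)) (sym (+-identityʳ m)))))
        (⟶h*≈-≈ (β-steps m 0 (l ∸ m) 0 (m+[n∸m]≡n m≤l))
                (λ w → trans (lamsApps-lamsApps m (l ∸ m) l (varAt (x + m + (l ∸ m))) F (λ i → hpArgs t (i + m)) w)
                             (cong₂ (λ a b → lamsApps a l (varAt b) F w) (m+[n∸m]≡n m≤l)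
                                    (trans (+-assoc x m (l ∸ m)) (cong (x +_) (m+[n∸m]≡n m≤l))))))
    args≈ : ∀ i → i < l → tm (F i) ≈T
                          tm (graft (l ∸ suc (to (lab t []) (to π i))) (padChild t (to π i)) (padChild s i))
    args≈ i i<l w with to π i <? m
    ... | yes πi<m
      rewrite padChild-< s i i<l =
      cong (λ z → graft z (childPT t (to π i)) (childPT s i) w)
           (trans (sym (+-∸-comm (l ∸ m) (permute-< (lab t []) (to π i) πi<m)))
                  (cong (_∸ suc (to (lab t []) (to π i))) (m+[n∸m]≡n m≤l)))
    ... | no πi≮m
      rewrite fixes (lab t []) (to π i) (≮⇒≥ πi≮m) | padChild-< s i i<l =
      sym (graft-identityʳ (argVar s i) (childPT s i) w)

  graft-hnf : GraftHNF (m ⊔ l)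
  graft-hnf with ≤-total l m
  ... | inj₁ l≤m = graft-hnf-≤ l≤m (m ⊔ l) (sym (m≥n⇒m⊔n≡m l≤m))
  ... | inj₂ m≤l = graft-hnf-≥ m≤l (m ⊔ l) (sym (m≤n⇒m⊔n≡n m≤l))

graft-BTnode : ∀ w x s t → InB (hpBT x (t · s)) w → BTnode (tm (graft x s t)) w (hpBTAt x (t · s) w)
graft-BTnode [] x s t _ with GraftReduction.graft-hnf x s t
... | F , reduction , _ =
  BTnode-⟶h*≈ reduction
    (subst (BTnode _ []) (cong (node N (x + N)) (length-applyUpTo (tm ∘ F) N))
           (root ε (HNF-lamsApps N N (x + N) F)))
  where
  N : ℕ
  N = ar t [] ⊔ ar s []
graft-BTnode (i ∷ w) x s t (i<N , inB) with GraftReduction.graft-hnf x s t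
... | F , reduction , args≈ =
  BTnode-⟶h*≈ reduction
    (child ε (HNF-lamsApps N N (x + N) F) i<length
           (BTnode-resp-≈ ith≈ (graft-BTnode w (argVar (t · s) i) (padChild t (to (lab s []) i)) (padChild s i) inB)))
  where
  N : ℕ
  N = ar t [] ⊔ ar s []
  i<length : i < length (applyUpTo (tm ∘ F) N)
  i<length = subst (i <_) (sym (length-applyUpTo (tm ∘ F) N)) i<N
  ith≈ : lookup (applyUpTo (tm ∘ F) N) (fromℕ< i<length) ≈T
         tm (graft (argVar (t · s) i) (padChild t (to (lab s []) i)) (padChild s i))
  ith≈ v = trans (cong (λ M → tat M v) (trans (lookup-applyUpTo (tm ∘ F) N (fromℕ< i<length))
                                              (cong (tm ∘ F) (toℕ-fromℕ< i<length))))
                 (args≈ i i<N v)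

-- The embedding and composition

φAt : PT → List ℕ → BL
φAt t [] = node (suc (ar t [])) (ar t []) (ar t [])
φAt t (i ∷ w) = hpBTAt 0 t (i ∷ w)

φ : PT → 𝓑
φ t = record { at = φAt t }

rename-emb-φ : ∀ t → rename suc (emb (φ t)) ≈T mkLam (tm (hpTm 0 t))
rename-emb-φ t [] = refl
rename-emb-φ t (_ ∷ w) =
  trans (renAt-cong suc 1 {N = tm (hpTm 0 t)}
                    (λ v → trans (lamsAt≡lamsApps (φ t) k k k v) (sym (hpTm-unfold 0 t v))) w)
        (renAt-hpTm-closed suc 1 0 t w (s≤s z≤n))
  where
  k : ℕ
  k = ar t []

compBody : PT → PT → Tm
compBody t u = mkApp (rename suc (emb (φ t))) (mkApp (rename suc (emb (φ u))) (mkVar zero))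

-- λx. φ t (φ u x): the outer β-step puts φ u x in head position of t's spine, and the inner
-- one turns φ u x into hpTm n u, n the number of binders of t's root.
compBody-⟶h*≈-graft : ∀ t u → compBody t u ⟶h*≈ tm (graft 0 u t)
compBody-⟶h*≈-graft t u =
  ⟶h*≈-trans (≈-⟶h-≈ (λ _ → refl) (β refl refl) outer≈)
             (≈-⟶h-≈ (λ _ → refl) (proj₁ (proj₂ inner)) (≈T-trans (proj₂ (proj₂ inner)) inner≈))
  where
  n : ℕ
  n = ar t []
  headRedex : List ℕ → TL
  headRedex = appAt (tat (mkLam (tm (hpTm 0 u)))) (varAt n)
  σ : ℕ → Tm
  σ = singleSub (subT (compBody t u) 1)

  head≡ : ∀ w → renAt ((n + 0) +_) 0 (subT (compBody t u) 1) w ≡ headRedex w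
  head≡ [] = refl
  head≡ (zero ∷ w) = trans (renAt-cong _ 0 (rename-emb-φ u) w) (underλ w)
    where
    underλ : ∀ w → renAt ((n + 0) +_) 0 (mkLam (tm (hpTm 0 u))) w ≡ tat (mkLam (tm (hpTm 0 u))) w
    underλ [] = refl
    underλ (_ ∷ w) = renAt-hpTm-closed _ 1 0 u w (s≤s z≤n)
  head≡ (suc zero ∷ []) = cong var (trans (+-identityʳ (n + 0)) (+-identityʳ n))
  head≡ (suc zero ∷ _ ∷ _) = refl
  head≡ (suc (suc _) ∷ []) = refl
  head≡ (suc (suc _) ∷ _ ∷ _) = refl

  outer≈ : subst0 (subT (subT (compBody t u) 0) 0) (subT (compBody t u) 1) ≈T tm (lamsApps n n headRedex (hpArgs t))
  outer≈ w =
    trans (subst0≈substAt (subT (subT (compBody t u) 0) 0) (subT (compBody t u) 1) w)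
    (trans (substAt-congʳ σ 0 (λ v → rename-emb-φ t (0 ∷ v)) w)
    (trans (substAt-hpTm-≥ σ 0 0 t w (λ ()))
           (lamsApps-cong′ n n w head≡ (λ _ _ _ → refl))))

  inner : Σ Tm λ M′ → tm (lamsApps n n headRedex (hpArgs t)) ⟶h M′ ×
                      M′ ≈T tm (lamsApps n n (tat (subst0 (tm (hpTm 0 u)) (tm (varAt n)))) (hpArgs t))
  inner = lamsApps-⟶h n n (tm headRedex) (hpArgs t) (λ ()) (β refl refl)

  inner≈ : tm (lamsApps n n (tat (subst0 (tm (hpTm 0 u)) (tm (varAt n)))) (hpArgs t)) ≈T tm (graft 0 u t)
  inner≈ w =
    lamsApps-cong′ n n w
      (λ v → trans (subst0≈substAt (tm (hpTm 0 u)) (tm (varAt n)) v)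
                   (substAt-hpTm-var (singleSub (tm (varAt n))) 0 0 u n v (λ ()) refl))
      (λ _ _ _ → refl)

φ-comp : ∀ t u → Comp (φ t) (φ u) (φ (t · u))
φ-comp t u [] _ =
  BTnode⇒BTpath (BTnode-⟶h*≈ (⟶h*≈-mkLam (compBody-⟶h*≈-graft t u))
                              (BTnode-mkLam-root (graft-BTnode [] 0 u t tt)))
φ-comp t u (i ∷ w) inB =
  BTnode⇒BTpath (BTnode-⟶h*≈ (⟶h*≈-mkLam (compBody-⟶h*≈-graft t u))
                              (BTnode-mkLam-child (graft-BTnode (i ∷ w) 0 u t inB)))

node-injective : ∀ {a b c a′ b′ c′} → node a b c ≡ node a′ b′ c′ → a ≡ a′ × b ≡ b′ × c ≡ c′
node-injective refl = refl , refl , refl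

node-cong : ∀ {a b c a′ b′ c′} → a ≡ a′ → b ≡ b′ → c ≡ c′ → node a b c ≡ node a′ b′ c′
node-cong refl refl refl = refl

InB-hpBT⇒InPT : ∀ w x t → InB (hpBT x t) w → InPT t w
InB-hpBT⇒InPT [] x t _ = tt
InB-hpBT⇒InPT (i ∷ w) x t (i<n , inB) = i<n , InB-hpBT⇒InPT w (argVar t i) (childPT t i) inB

hpBT-cong : ∀ w x t u → t ≈PT u → InPT t w → InPT u w → hpBTAt x t w ≡ hpBTAt x u w
hpBT-cong [] x t u t≈u _ _ = cong (λ a → node a (x + a) a) (proj₁ (t≈u [] tt tt))
hpBT-cong (i ∷ w) x t u t≈u (i<n , inT) (i<n′ , inU) =
  trans (hpBT-cong w (argVar t i) (childPT t i) (childPT u i)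
                   (λ v inT′ inU′ → t≈u (i ∷ v) (i<n , inT′) (i<n′ , inU′)) inT inU)
        (cong₂ (λ a b → hpBTAt (a ∸ suc b) (childPT u i) w) (proj₁ (t≈u [] tt tt)) (proj₂ (t≈u [] tt tt) i))

φ-cong : ∀ {t u} → t ≈PT u → φ t ≈B φ u
φ-cong t≈u [] _ _ = cong (λ a → node (suc a) a a) (proj₁ (t≈u [] tt tt))
φ-cong {t} {u} t≈u (i ∷ w) inT inU =
  hpBT-cong (i ∷ w) 0 t u t≈u (InB-hpBT⇒InPT (i ∷ w) 0 t inT) (InB-hpBT⇒InPT (i ∷ w) 0 u inU)

φ-ε̄ : φ ε̄ ≈B I𝓑
φ-ε̄ [] _ _ = refl
φ-ε̄ (i ∷ w) (() , _) _

-- A node records its permutation in the heads of its children: child j is headed by x_{π j}.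
hpBT-injective : ∀ w x y t u → hpBT x t ≈B hpBT y u → InPT t w → InPT u w →
                 ar t w ≡ ar u w × (∀ j → to (lab t w) j ≡ to (lab u w) j)
hpBT-injective [] x y t u t≈u _ _ = n≡n′ , to≡
  where
  n≡n′ : ar t [] ≡ ar u []
  n≡n′ = proj₁ (node-injective (t≈u [] tt tt))
  to≡ : ∀ j → to (lab t []) j ≡ to (lab u []) j
  to≡ j with j <? ar t []
  ... | yes j<n = suc-injective (∸-cancelˡ-≡ (permute-< (lab t []) j j<n) πu-bound argVar≡)
    where
    j<n′ : j < ar u []
    j<n′ = subst (j <_) n≡n′ j<n
    πu-bound : suc (to (lab u []) j) ≤ ar t []
    πu-bound = subst (suc (to (lab u []) j) ≤_) (sym n≡n′) (permute-< (lab u []) j j<n′)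
    childNode : hpBTAt x t (j ∷ []) ≡ hpBTAt y u (j ∷ [])
    childNode = t≈u (j ∷ []) (j<n , tt) (j<n′ , tt)
    argVar≡ : ar t [] ∸ suc (to (lab t []) j) ≡ ar t [] ∸ suc (to (lab u []) j)
    argVar≡ = trans (+-cancelʳ-≡ (ar t (j ∷ [])) _ _
                      (trans (proj₁ (proj₂ (node-injective childNode)))
                             (cong (argVar u j +_) (sym (proj₁ (node-injective childNode))))))
                    (cong (λ a → a ∸ suc (to (lab u []) j)) (sym n≡n′))
  ... | no j≮n = trans (fixes (lab t []) j (≮⇒≥ j≮n))
                       (sym (fixes (lab u []) j (≮⇒≥ (λ j<n′ → j≮n (subst (j <_) (sym n≡n′) j<n′)))))
hpBT-injective (i ∷ w) x y t u t≈u (i<n , inT) (i<n′ , inU) =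
  hpBT-injective w (argVar t i) (argVar u i) (childPT t i) (childPT u i)
                 (λ v inT′ inU′ → t≈u (i ∷ v) (i<n , inT′) (i<n′ , inU′)) inT inU

φ-injective : ∀ {t u} → φ t ≈B φ u → t ≈PT u
φ-injective {t} {u} φt≈φu w = hpBT-injective w 0 0 t u hpt≈hpu
  where
  hpt≈hpu : hpBT 0 t ≈B hpBT 0 u
  hpt≈hpu [] _ _ = cong (λ a → node a a a) (suc-injective (proj₁ (node-injective (φt≈φu [] tt tt))))
  hpt≈hpu (i ∷ v) = φt≈φu (i ∷ v)

-- The image

ptOf : (S : 𝓑) → ((w : List ℕ) → Sym (nLams S w)) → PT
ptOf S Π = record { ar = nLams S ; lab = Π }

hpBTAt-ptOf : ∀ w x S Π → hpBTAt x (ptOf S Π) w ≡ node (nLams S w) (expVar x S Π w + nLams S w) (nLams S w)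
hpBTAt-ptOf [] x S Π = refl
hpBTAt-ptOf (i ∷ w) x S Π = hpBTAt-ptOf w _ (sub𝓑 S i) (λ v → Π (i ∷ v))

HPv⇒hpBT : ∀ x S → HPv x S → ∃ λ t → ∀ w → InB S w → at S w ≡ hpBTAt x t w
HPv⇒hpBT x S (Π , isHP) = ptOf S Π , λ w inS → trans (isHP w inS) (sym (hpBTAt-ptOf w x S Π))

hpHead : ℕ → PT → List ℕ → ℕ
hpHead x t [] = x
hpHead x t (i ∷ w) = hpHead (argVar t i) (childPT t i) w

hpBTAt-head : ∀ w x t → hpBTAt x t w ≡ node (ar t w) (hpHead x t w + ar t w) (ar t w)
hpBTAt-head [] x t = refl
hpBTAt-head (i ∷ w) x t = hpBTAt-head w (argVar t i) (childPT t i)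

castSym : ∀ {a b} → Dec (a ≡ b) → Sym b → Sym a
castSym (yes a≡b) π = subst Sym (sym a≡b) π
castSym (no _) π = idSym _

to-castSym : ∀ {a b} (a≟b : Dec (a ≡ b)) (π : Sym b) → a ≡ b → ∀ j → to (castSym a≟b π) j ≡ to π j
to-castSym (yes refl) π _ j = refl
to-castSym (no a≢b) π a≡b j = ⊥-elim (a≢b a≡b)

-- the labels of t, read as permutations of the binders of S (junk where the arities differ)
labelsFor : (S : 𝓑) → PT → (w : List ℕ) → Sym (nLams S w)
labelsFor S t w = castSym (nLams S w ≟ ar t w) (lab t w)

expVar-labelsFor : ∀ w x S t → (∀ v → InB S v → at S v ≡ hpBTAt x t v) → InB S w →
                   expVar x S (labelsFor S t) w ≡ hpHead x t w
expVar-labelsFor [] x S t agree _ = refl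
expVar-labelsFor (i ∷ w) x S t agree (i<k , inS) =
  trans (cong (λ z → expVar z (sub𝓑 S i) (λ v → labelsFor S t (i ∷ v)) w) argVar≡)
        (expVar-labelsFor w (argVar t i) (sub𝓑 S i) (childPT t i) (λ v inS′ → agree (i ∷ v) (i<k , inS′)) inS)
  where
  n≡n′ : nLams S [] ≡ ar t []
  n≡n′ = cong lamsOf (agree [] tt)
  argVar≡ : nLams S [] ∸ suc (to (labelsFor S t []) i) ≡ argVar t i
  argVar≡ = cong₂ (λ a b → a ∸ suc b) n≡n′ (to-castSym (nLams S [] ≟ ar t []) (lab t []) n≡n′ i)

hpBT⇒HPv : ∀ x t S → (∀ w → InB S w → at S w ≡ hpBTAt x t w) → HPv x S
hpBT⇒HPv x t S agree = labelsFor S t , isHP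
  where
  isHP : ∀ w → InB S w →
         at S w ≡ node (nLams S w) (expVar x S (labelsFor S t) w + nLams S w) (nLams S w)
  isHP w inS = trans (agree w inS) (trans (hpBTAt-head w x t) (sym (node-cong n≡n (cong₂ _+_ head≡ n≡n) n≡n)))
    where
    n≡n : nLams S w ≡ ar t w
    n≡n = trans (cong lamsOf (agree w inS)) (cong lamsOf (hpBTAt-head w x t))
    head≡ : expVar x S (labelsFor S t) w ≡ hpHead x t w
    head≡ = expVar-labelsFor w x S t agree inS

strip-root : ∀ T {n y k} → at T [] ≡ node (suc n) y k → at (strip T) [] ≡ node n y k
strip-root T isλ rewrite isλ = refl

InB-strip⁺ : ∀ T {n y k} → at T [] ≡ node (suc n) y k → ∀ w → InB T w → InB (strip T) w
InB-strip⁺ T isλ [] _ = tt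
InB-strip⁺ T isλ (i ∷ w) inT with at T [] | isλ
... | _ | refl = inT

InB-strip⁻ : ∀ T {n y k} → at T [] ≡ node (suc n) y k → ∀ w → InB (strip T) w → InB T w
InB-strip⁻ T isλ [] _ = tt
InB-strip⁻ T isλ (i ∷ w) inS with at T [] | isλ
... | _ | refl = inS

InB-≈B : ∀ {T U} → T ≈B U → ∀ w → InB U w → InB T w
InB-≈B T≈U [] _ = tt
InB-≈B {T} {U} T≈U (i ∷ w) (childU , inU) =
  childT , InB-≈B (λ v inT′ inU′ → T≈U (i ∷ v) (childT , inT′) (childU , inU′)) w inU
  where
  childT : ChildOK (at T []) i
  childT = subst (λ L → ChildOK L i) (sym (T≈U [] tt tt)) childU

φ-≈B-strip : ∀ {t T} → φ t ≈B T →
             at T [] ≡ node (suc (ar t [])) (ar t []) (ar t []) ×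
             (∀ w → InB (strip T) w → at (strip T) w ≡ hpBTAt 0 t w)
φ-≈B-strip {t} {T} φt≈T = isλ , agree
  where
  isλ : at T [] ≡ node (suc (ar t [])) (ar t []) (ar t [])
  isλ = sym (φt≈T [] tt tt)
  agree : ∀ w → InB (strip T) w → at (strip T) w ≡ hpBTAt 0 t w
  agree [] _ = strip-root T isλ
  agree (i ∷ w) inS = sym (φt≈T (i ∷ w) (InB-≈B φt≈T (i ∷ w) inT) inT)
    where
    inT : InB T (i ∷ w)
    inT = InB-strip⁻ T isλ (i ∷ w) inS

strip-≈B-φ : ∀ {t T n y k} → at T [] ≡ node (suc n) y k →
             (∀ w → InB (strip T) w → at (strip T) w ≡ hpBTAt 0 t w) → φ t ≈B T
strip-≈B-φ {T = T} isλ agree [] _ _ with node-injective (trans (sym (strip-root T isλ)) (agree [] tt))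
... | refl , refl , refl = sym isλ
strip-≈B-φ {T = T} isλ agree (i ∷ w) _ inT = sym (agree (i ∷ w) (InB-strip⁺ T isλ (i ∷ w) inT))

HP⇔image-φ : ∀ T → HP T ⇔ (∃ λ t → φ t ≈B T)
HP⇔image-φ T = mk⇔ to′ from′
  where
  to′ : HP T → ∃ λ t → φ t ≈B T
  to′ ((_ , _ , _ , isλ) , isHP) with HPv⇒hpBT 0 (strip T) isHP
  ... | t , agree = t , strip-≈B-φ isλ agree
  from′ : (∃ λ t → φ t ≈B T) → HP T
  from′ (t , φt≈T) = (_ , _ , _ , proj₁ (φ-≈B-strip φt≈T)) , hpBT⇒HPv 0 t (strip T) (proj₂ (φ-≈B-strip φt≈T))

proposition4p1 : Σ (PT → 𝓑) λ φ →
    (∀ {t u} → t ≈PT u → φ t ≈B φ u)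
    × (∀ t u → Comp (φ t) (φ u) (φ (t · u)))
    × (φ ε̄ ≈B I𝓑)
    × (∀ {t u} → φ t ≈B φ u → t ≈PT u)
    × (∀ T → HP T ⇔ (∃ λ t → φ t ≈B T))
proposition4p1 = φ , φ-cong , φ-comp , φ-ε̄ , φ-injective , HP⇔image-φ
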